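{- Let $q$ be a prime power and $k$ a non-negative integer. Let $M$ be a simple and cosimple $GF(q)$-matroid that has two $k$-loose elements. Then $r(M) \leq (q+1)(k-1)+2q$.
   Context: A $GF(q)$-matroid is a matroid representable over the field with $q$ elements. For a matroid $M$ of rank $r$ and a non-negative integer $k$, an element of $M$ is called $k$-loose if every circuit of $M$ that contains it has size greater than $r-k$. A matroid is simple if it has no loops and no parallel pairs, and cosimple if its dual is simple. -}

module Defs where

open import Level using (Level; _⊔_) renaming (suc to lsuc)
import Data.Nat as ℕ
open import Data.Nat using (ℕ; zero; suc; _≤_; _^_)
open import Data.Nat.Primality using (Prime)
open import Data.Fin using (Fin)
import Data.Fin as Fin
open import Data.Fin.Subset using (Subset; _∈_; _∉_; _⊆_; _⊂_; ⁅_⁆; _∪_; ∁; ∣_∣)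
open import Data.Product using (Σ; ∃; _×_; _,_)
open import Relation.Nullary using (¬_)
open import Relation.Binary.PropositionalEquality using (_≡_; _≢_)
open import Algebra.Bundles using (CommutativeRing)

IsPrimePower : ℕ → Set
IsPrimePower q = Σ ℕ λ p → Σ ℕ λ m → Prime p × q ≡ p ^ suc m

record FiniteField (q : ℕ) (c ℓ : Level) : Set (lsuc (c ⊔ ℓ)) where
  field
    commRing : CommutativeRing c ℓ
  open CommutativeRing commRing public
  field
    0≉1     : ¬ (0# ≈ 1#)
    inverse : ∀ x → ¬ (x ≈ 0#) → Σ Carrier λ y → (x * y) ≈ 1#
    enum       : Fin q → Carrier
    enum-surj  : ∀ x → Σ (Fin q) λ i → enum i ≈ x
    enum-inj   : ∀ i j → enum i ≈ enum j → i ≡ j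

module MatroidNotions {ℓ : Level} {n : ℕ} (Indep : Subset n → Set ℓ) where

  Dependent : Subset n → Set ℓ
  Dependent S = ¬ Indep S

  Circuit : Subset n → Set ℓ
  Circuit C = Dependent C × (∀ D → D ⊂ C → Indep D)

  Basis : Subset n → Set ℓ
  Basis B = Indep B × (∀ S → B ⊂ S → Dependent S)

  HasRank : ℕ → Set ℓ
  HasRank r = Σ (Subset n) λ B → Basis B × ∣ B ∣ ≡ r

  Loop : Fin n → Set ℓ
  Loop e = Circuit ⁅ e ⁆

  ParallelPair : Fin n → Fin n → Set ℓ
  ParallelPair e f = e ≢ f × Circuit (⁅ e ⁆ ∪ ⁅ f ⁆)

  Simple : Set ℓ
  Simple = (∀ e → ¬ Loop e) × (∀ e f → ¬ ParallelPair e f)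

  -- the dual matroid: its bases are the complements of bases of M,
  -- so its independent sets are the sets avoiding some basis of M
  DualIndep : Subset n → Set ℓ
  DualIndep S = Σ (Subset n) λ B → Basis B × S ⊆ ∁ B

  -- an element e is k-loose if every circuit containing it has
  -- size greater than r - k (stated via the rank r of M; integers)
  KLoose : (r k : ℕ) → Fin n → Set ℓ
  KLoose r k e = ∀ C → Circuit C → e ∈ C → suc r ≤ ∣ C ∣ ℕ.+ k

open MatroidNotions public

Cosimple : ∀ {ℓ n} → (Subset n → Set ℓ) → Set ℓ
Cosimple Indep = Simple (DualIndep Indep)

-- Vector matroids over a finite field: columns v : Fin n → (Fin m → F)

module _ {q c ℓ} (F : FiniteField q c ℓ) where
  open FiniteField F

  Σ[_] : ∀ {n} → (Fin n → Carrier) → Carrier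
  Σ[_] {ℕ.zero}  f = 0#
  Σ[_] {ℕ.suc n} f = f Fin.zero + Σ[ (λ i → f (Fin.suc i)) ]

  VecIndep : ∀ {m n} → (Fin n → Fin m → Carrier) → Subset n → Set (c ⊔ ℓ)
  VecIndep {m} {n} v S =
    (a : Fin n → Carrier) →
    (∀ i → i ∉ S → a i ≈ 0#) →
    (∀ j → Σ[ (λ i → a i * v i j) ] ≈ 0#) →
    ∀ i → a i ≈ 0#

{-# OPTIONS --safe #-}
module Submission where

-- Let B be a basis of M (|B| = r) and e, f the two k-loose elements.  Since M is cosimple, {e, f}
-- avoids some basis, so the kernel of the column map (the cycle space of M) projects onto the
-- coordinates (e, f) with rank 2.  The fundamental vectors of B span that kernel, hence already two of
-- them, x and y, have independent (e, f)-projections; they are supported on B ∪ {a} and B ∪ {b}.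
-- The q + 1 kernel vectors x and y + t x (t ∈ GF(q)) are then all nonzero at e or at f, so each
-- support contains a circuit through e or f and has size at least r + 1 - k by looseness.  On the
-- other hand every coordinate of B ∪ {a, b} vanishes on at least one of these vectors and every other
-- coordinate on all of them, so their supports have total size at most q (r + 2).  Thus
-- (q + 1)(r + 1 - k) ≤ q (r + 2), which rearranges to r ≤ (q + 1)(k - 1) + 2q.

open import Defs
open import Level using (Level; _⊔_)
open import Data.Bool using (Bool; true; false; not)
open import Data.Empty using (⊥-elim)
open import Data.Fin as Fin using (Fin; zero; suc; punchIn)
open import Data.Fin.Properties using (punchInᵢ≢i)
open import Data.Fin.Subset using (Subset; _∈_; _∉_; _⊆_; _⊂_; ⁅_⁆; _∪_; ∣_∣; ⊤; ⊥)
open import Data.Fin.Subset.Properties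
  using ( _∈?_; ∈⊤; ⊆⊤; ⊥⊆; x∈⁅x⁆; x∈⁅y⁆⇒x≡y; x∉⁅y⁆⇒x≢y; x∈p∪q⁺; x∈p∪q⁻; x∈∁p⇒x∉p; p⊆p∪q; ∪-comm
        ; ⊆-⊂-trans; ∣⊤∣≡n; ∣⊥∣≡0; ∣⁅x⁆∣≡1; ∣p∣≤∣x∷p∣; p⊆q⇒∣p∣≤∣q∣; p⊂q⇒∣p∣<∣q∣ )
open import Data.Maybe using (nothing)
open import Data.Nat as ℕ using (ℕ; zero; suc; z≤n; s≤s)
open import Data.Nat.Induction using (<-wellFounded)
open import Data.Nat.Properties as ℕₚ using (≤-trans; ≤-reflexive; +-mono-≤; +-monoʳ-≤; +-suc; +-*-semiring)
open import Data.Product using (∃; ∃₂; _×_; _,_; proj₁; proj₂)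
open import Data.Sum using (_⊎_; inj₁; inj₂)
open import Data.Vec using ([]; _∷_; lookup; tabulate)
open import Data.Vec.Functional using (removeAt)
open import Data.Vec.Properties using (lookup∘tabulate; []=⇒lookup; lookup⇒[]=)
open import Function using (_∘_)
open import Induction.WellFounded using (Acc; acc)
open import Relation.Binary.PropositionalEquality as ≡ using (_≡_; _≢_)
open import Relation.Nullary using (¬_; Dec; yes; no; does)
open import Relation.Nullary.Decidable using (dec-true; dec-false; decidable-stable; ¬¬-excluded-middle)
open import Tactic.RingSolver.Core.AlmostCommutativeRing using (AlmostCommutativeRing; fromCommutativeRing)
import Algebra.Properties.Semiring.Sum as SemiringSum

-- The argument is classical (minimal dependent sets, choice of fundamental vectors); it runs in the
-- double-negation monad, which is harmless because the final inequality is decidable.  The stdlib's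
-- ¬¬-Monad is single-level, so bind is restated level-heterogeneously.
infixl 1 _>>=_

_>>=_ : ∀ {a b} {A : Set a} {B : Set b} → ¬ ¬ A → (A → ¬ ¬ B) → ¬ ¬ B
(¬¬a >>= k) ¬b = ¬¬a (λ a → k a ¬b)

return : ∀ {a} {A : Set a} → A → ¬ ¬ A
return a ¬a = ¬a a

¬¬-∀-Fin : ∀ {a n} {P : Fin n → Set a} → (∀ i → ¬ ¬ P i) → ¬ ¬ (∀ i → P i)
¬¬-∀-Fin {n = zero}  _   = return (λ ())
¬¬-∀-Fin {n = suc n} ¬¬P = do
  p₀ ← ¬¬P zero
  p₊ ← ¬¬-∀-Fin (λ i → ¬¬P (suc i))
  return λ where
    zero    → p₀
    (suc i) → p₊ i

module ℕΣ = SemiringSum +-*-semiring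
open ℕΣ using (sum)

-- ℕ's _+_, _*_ and _≤_ are opened only locally: the field operations and ℤ's _≤_ use the same names.
module _ where
  open import Data.Nat using (_+_; _*_; _≤_; _<_)

  ∑-mono-≤ : ∀ {n} {f g : Fin n → ℕ} → (∀ i → f i ≤ g i) → sum f ≤ sum g
  ∑-mono-≤ {zero}  f≤g = z≤n
  ∑-mono-≤ {suc n} f≤g = +-mono-≤ (f≤g zero) (∑-mono-≤ (λ i → f≤g (suc i)))

  ∑-const : ∀ n c → sum {n} (λ _ → c) ≡ n * c
  ∑-const zero    c = ≡.refl
  ∑-const (suc n) c = ≡.cong (c +_) (∑-const n c)

  indicator : Bool → ℕ
  indicator true  = 1
  indicator false = 0

  ∣p∣≡∑ : ∀ {n} (p : Subset n) → ∣ p ∣ ≡ sum (λ i → indicator (lookup p i))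
  ∣p∣≡∑ []          = ≡.refl
  ∣p∣≡∑ (true ∷ p)  = ≡.cong suc (∣p∣≡∑ p)
  ∣p∣≡∑ (false ∷ p) = ∣p∣≡∑ p

  ∣tabulate∣≡∑ : ∀ {n} (b : Fin n → Bool) → ∣ tabulate b ∣ ≡ sum (λ i → indicator (b i))
  ∣tabulate∣≡∑ b = ≡.trans (∣p∣≡∑ (tabulate b)) (ℕΣ.sum-cong-≗ (λ i → ≡.cong indicator (lookup∘tabulate b i)))

  ∑∣rows∣≡∑∣columns∣ : ∀ {m n} (M : Fin m → Fin n → Bool) →
                       sum (λ s → ∣ tabulate (M s) ∣) ≡ sum (λ i → ∣ tabulate (λ s → M s i) ∣)
  ∑∣rows∣≡∑∣columns∣ M = begin
    sum (λ s → ∣ tabulate (M s) ∣)              ≡⟨ ℕΣ.sum-cong-≗ (λ s → ∣tabulate∣≡∑ (M s)) ⟩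
    sum (λ s → sum (λ i → indicator (M s i)))   ≡⟨ ℕΣ.∑-comm (λ s i → indicator (M s i)) ⟩
    sum (λ i → sum (λ s → indicator (M s i)))   ≡⟨ ℕΣ.sum-cong-≗ (λ i → ∣tabulate∣≡∑ (λ s → M s i)) ⟨
    sum (λ i → ∣ tabulate (λ s → M s i) ∣)      ∎
    where open ≡.≡-Reasoning

  ∣p∪q∣≤∣p∣+∣q∣ : ∀ {n} (p q : Subset n) → ∣ p ∪ q ∣ ≤ ∣ p ∣ + ∣ q ∣
  ∣p∪q∣≤∣p∣+∣q∣ []          []          = z≤n
  ∣p∪q∣≤∣p∣+∣q∣ (true ∷ p)  (s ∷ q)     = s≤s (≤-trans (∣p∪q∣≤∣p∣+∣q∣ p q) (+-monoʳ-≤ ∣ p ∣ (∣p∣≤∣x∷p∣ s q)))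
  ∣p∪q∣≤∣p∣+∣q∣ (false ∷ p) (true ∷ q)  =
    ≤-trans (s≤s (∣p∪q∣≤∣p∣+∣q∣ p q)) (≤-reflexive (≡.sym (+-suc ∣ p ∣ ∣ q ∣)))
  ∣p∪q∣≤∣p∣+∣q∣ (false ∷ p) (false ∷ q) = ∣p∪q∣≤∣p∣+∣q∣ p q

  ∣p∪⁅x⁆∪⁅y⁆∣≤∣p∣+2 : ∀ {n} (p : Subset n) x y → ∣ p ∪ ⁅ x ⁆ ∪ ⁅ y ⁆ ∣ ≤ ∣ p ∣ + 2
  ∣p∪⁅x⁆∪⁅y⁆∣≤∣p∣+2 p x y = ≤-trans (∣p∪q∣≤∣p∣+∣q∣ p (⁅ x ⁆ ∪ ⁅ y ⁆)) (+-monoʳ-≤ ∣ p ∣ ∣⁅x⁆∪⁅y⁆∣≤2)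
    where
    ∣⁅x⁆∪⁅y⁆∣≤2 : ∣ ⁅ x ⁆ ∪ ⁅ y ⁆ ∣ ≤ 2
    ∣⁅x⁆∪⁅y⁆∣≤2 = ≤-trans (∣p∪q∣≤∣p∣+∣q∣ ⁅ x ⁆ ⁅ y ⁆) (≤-reflexive (≡.cong₂ _+_ (∣⁅x⁆∣≡1 x) (∣⁅x⁆∣≡1 y)))

  x∉p⇒∣p∣<n : ∀ {n} {x : Fin n} {p : Subset n} → x ∉ p → ∣ p ∣ < n
  x∉p⇒∣p∣<n {n} {x} {p} x∉p = ≡.subst (∣ p ∣ <_) (∣⊤∣≡n n) (p⊂q⇒∣p∣<∣q∣ (⊆⊤ , x , ∈⊤ , x∉p))

x∉p∧x≢y⇒x∉p∪⁅y⁆ : ∀ {n} {p : Subset n} {x y} → x ∉ p → x ≢ y → x ∉ p ∪ ⁅ y ⁆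
x∉p∧x≢y⇒x∉p∪⁅y⁆ {p = p} {y = y} x∉p x≢y x∈ with x∈p∪q⁻ p ⁅ y ⁆ x∈
... | inj₁ x∈p   = x∉p x∈p
... | inj₂ x∈⁅y⁆ = x≢y (x∈⁅y⁆⇒x≡y y x∈⁅y⁆)

x∉p⇒p⊂p∪⁅x⁆ : ∀ {n} {p : Subset n} {x} → x ∉ p → p ⊂ p ∪ ⁅ x ⁆
x∉p⇒p⊂p∪⁅x⁆ {x = x} x∉p = p⊆p∪q ⁅ x ⁆ , x , x∈p∪q⁺ (inj₂ (x∈⁅x⁆ x)) , x∉p

x∉p∪q⇒x∉p×x∉q : ∀ {n} {p q : Subset n} {x} → x ∉ p ∪ q → x ∉ p × x ∉ q
x∉p∪q⇒x∉p×x∉q x∉ = x∉ ∘ x∈p∪q⁺ ∘ inj₁ , x∉ ∘ x∈p∪q⁺ ∘ inj₂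

x∉p∪⁅y⁆∪⁅z⁆⇒x∉p×x≢y×x≢z : ∀ {n} {p : Subset n} {x y z} → x ∉ p ∪ ⁅ y ⁆ ∪ ⁅ z ⁆ → x ∉ p × x ≢ y × x ≢ z
x∉p∪⁅y⁆∪⁅z⁆⇒x∉p×x≢y×x≢z x∉ =
  let x∉p , x∉⁅y⁆∪⁅z⁆ = x∉p∪q⇒x∉p×x∉q x∉
      x∉⁅y⁆ , x∉⁅z⁆   = x∉p∪q⇒x∉p×x∉q x∉⁅y⁆∪⁅z⁆
  in x∉p , x∉⁅y⁆⇒x≢y x∉⁅y⁆ , x∉⁅y⁆⇒x≢y x∉⁅z⁆

p⊂⁅x⁆⇒p⊆⊥ : ∀ {n} {p : Subset n} {x} → p ⊂ ⁅ x ⁆ → p ⊆ ⊥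
p⊂⁅x⁆⇒p⊆⊥ {p = p} {x} (p⊆⁅x⁆ , y , y∈⁅x⁆ , y∉p) {z} z∈p = ⊥-elim (y∉p (≡.subst (_∈ p) z≡y z∈p))
  where
  z≡y : z ≡ y
  z≡y = ≡.trans (x∈⁅y⁆⇒x≡y x (p⊆⁅x⁆ z∈p)) (≡.sym (x∈⁅y⁆⇒x≡y x y∈⁅x⁆))

p⊆⁅x⁆∪q∧x∉p⇒p⊆q : ∀ {n} {p q : Subset n} {x} → p ⊆ ⁅ x ⁆ ∪ q → x ∉ p → p ⊆ q
p⊆⁅x⁆∪q∧x∉p⇒p⊆q {p = p} {q} {x} p⊆ x∉p {z} z∈p with x∈p∪q⁻ ⁅ x ⁆ q (p⊆ z∈p)
... | inj₁ z∈⁅x⁆ = ⊥-elim (x∉p (≡.subst (_∈ p) (x∈⁅y⁆⇒x≡y x z∈⁅x⁆) z∈p))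
... | inj₂ z∈q   = z∈q

p⊂⁅x⁆∪⁅y⁆⇒p⊆⁅x⁆⊎p⊆⁅y⁆ : ∀ {n} {p : Subset n} {x y} → p ⊂ ⁅ x ⁆ ∪ ⁅ y ⁆ → p ⊆ ⁅ x ⁆ ⊎ p ⊆ ⁅ y ⁆
p⊂⁅x⁆∪⁅y⁆⇒p⊆⁅x⁆⊎p⊆⁅y⁆ {p = p} {x} {y} (p⊆ , z , z∈ , z∉p) with x∈p∪q⁻ ⁅ x ⁆ ⁅ y ⁆ z∈
... | inj₁ z∈⁅x⁆ = inj₂ (p⊆⁅x⁆∪q∧x∉p⇒p⊆q p⊆ (≡.subst (_∉ p) (x∈⁅y⁆⇒x≡y x z∈⁅x⁆) z∉p))
... | inj₂ z∈⁅y⁆ = inj₁ (p⊆⁅x⁆∪q∧x∉p⇒p⊆q (≡.subst (p ⊆_) (∪-comm ⁅ x ⁆ ⁅ y ⁆) p⊆)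
                                          (≡.subst (_∉ p) (x∈⁅y⁆⇒x≡y y z∈⁅y⁆) z∉p))

module _ {ℓ n} {J : Subset n → Set ℓ} (J-⊆ : ∀ {S T} → S ⊆ T → J T → J S) (J-⊥ : J ⊥) where

  simple⇒¬¬pair-independent : Simple J → ∀ {e f} → e ≢ f → ¬ ¬ J (⁅ e ⁆ ∪ ⁅ f ⁆)
  simple⇒¬¬pair-independent (no-loops , no-parallel-pairs) {e} {f} e≢f = do
    Je ← singleton-independent e
    Jf ← singleton-independent f
    λ ¬J → no-parallel-pairs e f (e≢f , ¬J , proper-subsets-independent Je Jf)
    where
    singleton-independent : ∀ x → ¬ ¬ J ⁅ x ⁆
    singleton-independent x ¬J = no-loops x (¬J , λ D D⊂ → J-⊆ (p⊂⁅x⁆⇒p⊆⊥ D⊂) J-⊥)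

    proper-subsets-independent : J ⁅ e ⁆ → J ⁅ f ⁆ → ∀ D → D ⊂ ⁅ e ⁆ ∪ ⁅ f ⁆ → J D
    proper-subsets-independent Je Jf D D⊂ with p⊂⁅x⁆∪⁅y⁆⇒p⊆⁅x⁆⊎p⊆⁅y⁆ D⊂
    ... | inj₁ D⊆⁅e⁆ = J-⊆ D⊆⁅e⁆ Je
    ... | inj₂ D⊆⁅f⁆ = J-⊆ D⊆⁅f⁆ Jf

module _ {ℓ n} {Indep : Subset n → Set ℓ} where

  DualIndep-⊆ : ∀ {S T} → S ⊆ T → DualIndep Indep T → DualIndep Indep S
  DualIndep-⊆ S⊆T (B , basis , T⊆∁B) = B , basis , λ {i} i∈S → T⊆∁B (S⊆T i∈S)

  cosimple⇒¬¬pair-coindependent : ∀ {B e f} → Basis Indep B → Cosimple Indep → e ≢ f →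
                                  ¬ ¬ DualIndep Indep (⁅ e ⁆ ∪ ⁅ f ⁆)
  cosimple⇒¬¬pair-coindependent {B} basis cosimple =
    simple⇒¬¬pair-independent DualIndep-⊆ (B , basis , ⊥⊆) cosimple

module FieldProperties {q c ℓ} (F : FiniteField q c ℓ) where
  open FiniteField F hiding (zero)
  open import Algebra.Properties.Ring ring using (-0#≈0#; -‿distribˡ-*)
  open SemiringSum semiring public
    using (sum-cong-≋; sum-remove; sum-replicate-zero; ∑-distrib-+; ∑-comm; *-distribˡ-sum; *-distribʳ-sum)
    renaming (sum to ∑)
  open import Relation.Binary.Reasoning.Setoid setoid

  private
    acr : AlmostCommutativeRing c ℓ
    acr = fromCommutativeRing commRing (λ _ → nothing)

  -- With no zero test on the carrier this solver cannot cancel x + - x, and it does not move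
  -- negations; it is only used for identities free of -_.
  open import Tactic.RingSolver.NonReflective acr using (solve; _⊜_; _⊕_; _⊗_)

  infix 4 _≈?_
  _≈?_ : ∀ x y → Dec (x ≈ y)
  x ≈? y with enum-surj x | enum-surj y
  ... | i , eᵢ≈x | j , eⱼ≈y with i Fin.≟ j
  ...   | yes ≡.refl = yes (trans (sym eᵢ≈x) eⱼ≈y)
  ...   | no i≢j     = no λ x≈y → i≢j (enum-inj i j (trans eᵢ≈x (trans x≈y (sym eⱼ≈y))))

  affine-root : ∀ {x} → ¬ x ≈ 0# → ∀ y → ∃ λ t → y + t * x ≈ 0#
  affine-root {x} x≉0 y with inverse x x≉0
  ... | x⁻¹ , xx⁻¹≈1 = - (y * x⁻¹) , (begin
    y + - (y * x⁻¹) * x    ≈⟨ +-congˡ (-‿distribˡ-* (y * x⁻¹) x) ⟨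
    y + - (y * x⁻¹ * x)    ≈⟨ +-congˡ (-‿cong (solve 3 (λ x y z → (y ⊗ z ⊗ x) ⊜ (y ⊗ (x ⊗ z))) refl x y x⁻¹)) ⟩
    y + - (y * (x * x⁻¹))  ≈⟨ +-congˡ (-‿cong (*-congˡ xx⁻¹≈1)) ⟩
    y + - (y * 1#)         ≈⟨ +-congˡ (-‿cong (*-identityʳ y)) ⟩
    y + - y                ≈⟨ -‿inverseʳ y ⟩
    0#                     ∎)

  -x*y≈-y*x : ∀ x y → - x * y ≈ - y * x
  -x*y≈-y*x x y = begin
    - x * y    ≈⟨ -‿distribˡ-* x y ⟨
    - (x * y)  ≈⟨ -‿cong (*-comm x y) ⟩
    - (y * x)  ≈⟨ -‿distribˡ-* y x ⟩
    - y * x    ∎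

  Σ≡∑ : ∀ {n} (w : Fin n → Carrier) → Σ[ F ] w ≡ ∑ w
  Σ≡∑ {zero}  w = ≡.refl
  Σ≡∑ {suc n} w = ≡.cong (w zero +_) (Σ≡∑ (λ i → w (suc i)))

  ∑-zero : ∀ {n} {w : Fin n → Carrier} → (∀ i → w i ≈ 0#) → ∑ w ≈ 0#
  ∑-zero {n} w≈0 = trans (sum-cong-≋ w≈0) (sum-replicate-zero n)

  ∑-single : ∀ {n} (w : Fin n → Carrier) i → (∀ j → j ≢ i → w j ≈ 0#) → ∑ w ≈ w i
  ∑-single {suc n} w i w≈0 = begin
    ∑ w                     ≈⟨ sum-remove w ⟩
    w i + ∑ (removeAt w i)  ≈⟨ +-congˡ (∑-zero (λ j → w≈0 (punchIn i j) (punchInᵢ≢i i j))) ⟩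
    w i + 0#                ≈⟨ +-identityʳ (w i) ⟩
    w i                     ∎

  nonzero : Carrier → Bool
  nonzero x = not (does (x ≈? 0#))

  support : ∀ {n} → (Fin n → Carrier) → Subset n
  support w = tabulate (λ i → nonzero (w i))

  VanishesOutside : ∀ {n} → Subset n → (Fin n → Carrier) → Set ℓ
  VanishesOutside S w = ∀ i → i ∉ S → w i ≈ 0#

  module _ {n} {w : Fin n → Carrier} where

    ∈-support⁺ : ∀ {i} → ¬ w i ≈ 0# → i ∈ support w
    ∈-support⁺ {i} wᵢ≉0 = lookup⇒[]= i (support w)
      (≡.trans (lookup∘tabulate _ i) (≡.cong not (dec-false (w i ≈? 0#) wᵢ≉0)))

    ∈-support⁻ : ∀ {i} → i ∈ support w → ¬ w i ≈ 0#
    ∈-support⁻ {i} i∈ wᵢ≈0 with ≡.trans (≡.sym ([]=⇒lookup i∈))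
                                  (≡.trans (lookup∘tabulate _ i) (≡.cong not (dec-true (w i ≈? 0#) wᵢ≈0)))
    ... | ()

    vanishesOutside-support : VanishesOutside (support w) w
    vanishesOutside-support i i∉ = decidable-stable (w i ≈? 0#) (λ wᵢ≉0 → i∉ (∈-support⁺ wᵢ≉0))

    vanishesOutside⇒support-⊆ : ∀ {S} → VanishesOutside S w → support w ⊆ S
    vanishesOutside⇒support-⊆ {S} w≈0 {i} i∈ = decidable-stable (i ∈? S) (λ i∉S → ∈-support⁻ i∈ (w≈0 i i∉S))

  -- det x y is the 2 × 2 minor x e * y f - x f * y e, written as a linear form in y.
  module TwoCoordinates {n} (e f : Fin n) where

    form : Carrier → Carrier → (Fin n → Carrier) → Carrier
    form α β w = α * w e + β * w f

    det : (Fin n → Carrier) → (Fin n → Carrier) → Carrier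
    det x y = form (- x f) (x e) y

    module _ {α β : Carrier} where

      form-cong : ∀ {w w′} → (∀ i → w i ≈ w′ i) → form α β w ≈ form α β w′
      form-cong w≈w′ = +-cong (*-congˡ (w≈w′ e)) (*-congˡ (w≈w′ f))

      form-vanishing : ∀ {w} → w e ≈ 0# → w f ≈ 0# → form α β w ≈ 0#
      form-vanishing wₑ≈0 w_f≈0 = begin
        α * _ + β * _    ≈⟨ +-cong (*-congˡ wₑ≈0) (*-congˡ w_f≈0) ⟩
        α * 0# + β * 0#  ≈⟨ +-cong (zeroʳ α) (zeroʳ β) ⟩
        0# + 0#          ≈⟨ +-identityʳ 0# ⟩
        0#               ∎

      form-+* : ∀ w t w′ → form α β (λ i → w i + t * w′ i) ≈ form α β w + t * form α β w′
      form-+* w t w′ = solve 7 (λ α β wₑ w_f t w′ₑ w′_f →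
        (α ⊗ (wₑ ⊕ t ⊗ w′ₑ) ⊕ β ⊗ (w_f ⊕ t ⊗ w′_f)) ⊜ ((α ⊗ wₑ ⊕ β ⊗ w_f) ⊕ t ⊗ (α ⊗ w′ₑ ⊕ β ⊗ w′_f)))
        refl α β (w e) (w f) t (w′ e) (w′ f)

      form-* : ∀ t w → form α β (λ i → t * w i) ≈ t * form α β w
      form-* t w = solve 5 (λ α β t wₑ w_f → (α ⊗ (t ⊗ wₑ) ⊕ β ⊗ (t ⊗ w_f)) ⊜ (t ⊗ (α ⊗ wₑ ⊕ β ⊗ w_f)))
        refl α β t (w e) (w f)

      form-∑ : ∀ {k} (W : Fin k → Fin n → Carrier) →
               form α β (λ i → ∑ (λ g → W g i)) ≈ ∑ (λ g → form α β (W g))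
      form-∑ W = begin
        α * ∑ (λ g → W g e) + β * ∑ (λ g → W g f)  ≈⟨ +-cong (*-distribˡ-sum α (λ g → W g e))
                                                             (*-distribˡ-sum β (λ g → W g f)) ⟩
        ∑ (λ g → α * W g e) + ∑ (λ g → β * W g f)  ≈⟨ ∑-distrib-+ (λ g → α * W g e) (λ g → β * W g f) ⟨
        ∑ (λ g → form α β (W g))                    ∎

    det-as-form-of-first : ∀ x y → det x y ≈ form (y f) (- y e) x
    det-as-form-of-first x y = begin
      - x f * y e + x e * y f  ≈⟨ +-comm _ _ ⟩
      x e * y f + - x f * y e  ≈⟨ +-cong (*-comm (x e) (y f)) (-x*y≈-y*x (x f) (y e)) ⟩
      y f * x e + - y e * x f  ∎

    det-self : ∀ x → det x x ≈ 0#
    det-self x = begin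
      - x f * x e + x e * x f    ≈⟨ +-congʳ (-‿distribˡ-* (x f) (x e)) ⟨
      - (x f * x e) + x e * x f  ≈⟨ +-congʳ (-‿cong (*-comm (x f) (x e))) ⟩
      - (x e * x f) + x e * x f  ≈⟨ -‿inverseˡ (x e * x f) ⟩
      0#                         ∎

    det-shear : ∀ x y t → det x (λ i → y i + t * x i) ≈ det x y
    det-shear x y t = begin
      det x (λ i → y i + t * x i)  ≈⟨ form-+* y t x ⟩
      det x y + t * det x x        ≈⟨ +-congˡ (*-congˡ (det-self x)) ⟩
      det x y + t * 0#             ≈⟨ +-congˡ (zeroʳ t) ⟩
      det x y + 0#                 ≈⟨ +-identityʳ (det x y) ⟩
      det x y                      ∎

    det-vanishingˡ : ∀ {x} y → x e ≈ 0# → x f ≈ 0# → det x y ≈ 0#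
    det-vanishingˡ {x} y xₑ≈0 x_f≈0 = begin
      - x f * y e + x e * y f  ≈⟨ +-cong (*-congʳ (trans (-‿cong x_f≈0) -0#≈0#)) (*-congʳ xₑ≈0) ⟩
      0# * y e + 0# * y f      ≈⟨ +-cong (zeroˡ (y e)) (zeroˡ (y f)) ⟩
      0# + 0#                  ≈⟨ +-identityʳ 0# ⟩
      0#                       ∎

    det-units : ∀ {x y} → x e ≈ 1# → x f ≈ 0# → y e ≈ 0# → y f ≈ 1# → det x y ≈ 1#
    det-units {x} {y} xₑ≈1 x_f≈0 yₑ≈0 y_f≈1 = begin
      - x f * y e + x e * y f  ≈⟨ +-cong (*-congˡ yₑ≈0) (*-cong xₑ≈1 y_f≈1) ⟩
      - x f * 0# + 1# * 1#     ≈⟨ +-cong (zeroʳ (- x f)) (*-identityˡ 1#) ⟩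
      0# + 1#                  ≈⟨ +-identityˡ 1# ⟩
      1#                       ∎

-- pencil s, for s ∈ Fin (suc q), runs over representatives x and y + t x of the q + 1 points of
-- the projective line spanned by x and y.
module Pencil {q c ℓ} (F : FiniteField q c ℓ) {n} (x y : Fin n → FiniteField.Carrier F) where
  open FiniteField F hiding (zero)
  open FieldProperties F
  open import Data.Nat using (_≤_)

  pencil : Fin (suc q) → Fin n → Carrier
  pencil zero    = x
  pencil (suc t) = λ i → y i + enum t * x i

  pencil-vanishes-somewhere : ∀ i → ∃ λ s → pencil s i ≈ 0#
  pencil-vanishes-somewhere i with x i ≈? 0#
  ... | yes xᵢ≈0 = zero , xᵢ≈0
  ... | no xᵢ≉0 with affine-root xᵢ≉0 (y i)
  ...   | t , y+tx≈0 with enum-surj t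
  ...     | s , eₛ≈t = suc s , trans (+-congˡ (*-congʳ eₛ≈t)) y+tx≈0

  pencil-vanishesOutside : ∀ {S} → VanishesOutside S x → VanishesOutside S y → ∀ s → VanishesOutside S (pencil s)
  pencil-vanishesOutside x≈0 y≈0 zero    i i∉ = x≈0 i i∉
  pencil-vanishesOutside x≈0 y≈0 (suc t) i i∉ =
    trans (+-cong (y≈0 i i∉) (trans (*-congˡ (x≈0 i i∉)) (zeroʳ (enum t)))) (+-identityʳ 0#)

  column : Fin n → Subset (suc q)
  column i = support (λ s → pencil s i)

  ∣column∣≤q : ∀ i → ∣ column i ∣ ≤ q
  ∣column∣≤q i = let s , pencilₛᵢ≈0 = pencil-vanishes-somewhere i in
    ℕₚ.≤-pred (x∉p⇒∣p∣<n {x = s} {p = column i} (λ s∈ → ∈-support⁻ {w = λ t → pencil t i} s∈ pencilₛᵢ≈0))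

  ∑∣support∣≤q*∣T∣ : ∀ {T} → VanishesOutside T x → VanishesOutside T y →
                     sum (λ s → ∣ support (pencil s) ∣) ≤ q ℕ.* ∣ T ∣
  ∑∣support∣≤q*∣T∣ {T} x≈0 y≈0 = begin
    sum (λ s → ∣ support (pencil s) ∣)        ≡⟨ ∑∣rows∣≡∑∣columns∣ (λ s i → nonzero (pencil s i)) ⟩
    sum (λ i → ∣ column i ∣)                  ≤⟨ ∑-mono-≤ column-bound ⟩
    sum (λ i → q ℕ.* indicator (lookup T i))  ≡⟨ ℕΣ.*-distribˡ-sum q (λ i → indicator (lookup T i)) ⟨
    q ℕ.* sum (λ i → indicator (lookup T i))  ≡⟨ ≡.cong (q ℕ.*_) (∣p∣≡∑ T) ⟨
    q ℕ.* ∣ T ∣                               ∎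
    where
    open ℕₚ.≤-Reasoning
    column-bound : ∀ i → ∣ column i ∣ ≤ q ℕ.* indicator (lookup T i)
    column-bound i with i ∈? T
    ... | yes i∈T rewrite []=⇒lookup i∈T = ≤-trans (∣column∣≤q i) (≤-reflexive (≡.sym (ℕₚ.*-identityʳ q)))
    ... | no i∉T = ≤-trans (p⊆q⇒∣p∣≤∣q∣ column⊆⊥) (≤-trans (≤-reflexive (∣⊥∣≡0 (suc q))) z≤n)
      where
      column⊆⊥ : column i ⊆ ⊥
      column⊆⊥ = vanishesOutside⇒support-⊆ (λ s _ → pencil-vanishesOutside x≈0 y≈0 s i i∉T)

  module _ (e f : Fin n) where
    open TwoCoordinates e f

    vanishing-member⇒det≈0 : ∀ s → pencil s e ≈ 0# → pencil s f ≈ 0# → det x y ≈ 0#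
    vanishing-member⇒det≈0 zero    xₑ≈0 x_f≈0 = det-vanishingˡ y xₑ≈0 x_f≈0
    vanishing-member⇒det≈0 (suc t) wₑ≈0 w_f≈0 = trans (sym (det-shear x y (enum t))) (form-vanishing wₑ≈0 w_f≈0)

    pencil-nonzero : ¬ det x y ≈ 0# → ∀ s → ¬ pencil s e ≈ 0# ⊎ ¬ pencil s f ≈ 0#
    pencil-nonzero det≉0 s with pencil s e ≈? 0# | pencil s f ≈? 0#
    ... | no wₑ≉0  | _         = inj₁ wₑ≉0
    ... | yes _    | no w_f≉0  = inj₂ w_f≉0
    ... | yes wₑ≈0 | yes w_f≈0 = ⊥-elim (det≉0 (vanishing-member⇒det≈0 s wₑ≈0 w_f≈0))

module VectorMatroid {q c ℓ} (F : FiniteField q c ℓ) {m n : ℕ} (v : Fin n → Fin m → FiniteField.Carrier F) where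
  open FiniteField F hiding (zero)
  open FieldProperties F
  open import Algebra.Properties.Ring ring using (-1*x≈-x; x∙y⁻¹≈ε⇒x≈y)
  open import Data.Nat using (_≤_; _<_)
  open import Relation.Binary.Reasoning.Setoid setoid

  Ind : Subset n → Set (c ⊔ ℓ)
  Ind = VecIndep F v

  Kernel : (Fin n → Carrier) → Set ℓ
  Kernel w = ∀ j → Σ[ F ] (λ i → w i * v i j) ≈ 0#

  private
    kernel⇒∑≈0 : ∀ {w} → Kernel w → ∀ j → ∑ (λ i → w i * v i j) ≈ 0#
    kernel⇒∑≈0 {w} kw j = ≡.subst (_≈ 0#) (Σ≡∑ (λ i → w i * v i j)) (kw j)

    ∑≈0⇒kernel : ∀ {w} → (∀ j → ∑ (λ i → w i * v i j) ≈ 0#) → Kernel w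
    ∑≈0⇒kernel {w} ∑≈0 j = ≡.subst (_≈ 0#) (≡.sym (Σ≡∑ (λ i → w i * v i j))) (∑≈0 j)

  Kernel-0 : Kernel (λ _ → 0#)
  Kernel-0 = ∑≈0⇒kernel λ j → ∑-zero (λ i → zeroˡ (v i j))

  Kernel-+ : ∀ {w w′} → Kernel w → Kernel w′ → Kernel (λ i → w i + w′ i)
  Kernel-+ {w} {w′} kw kw′ = ∑≈0⇒kernel λ j → begin
    ∑ (λ i → (w i + w′ i) * v i j)                  ≈⟨ sum-cong-≋ (λ i → distribʳ (v i j) (w i) (w′ i)) ⟩
    ∑ (λ i → w i * v i j + w′ i * v i j)            ≈⟨ ∑-distrib-+ (λ i → w i * v i j) (λ i → w′ i * v i j) ⟩
    ∑ (λ i → w i * v i j) + ∑ (λ i → w′ i * v i j)  ≈⟨ +-cong (kernel⇒∑≈0 kw j) (kernel⇒∑≈0 kw′ j) ⟩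
    0# + 0#                                         ≈⟨ +-identityʳ 0# ⟩
    0#                                              ∎

  Kernel-* : ∀ t {w} → Kernel w → Kernel (λ i → t * w i)
  Kernel-* t {w} kw = ∑≈0⇒kernel λ j → begin
    ∑ (λ i → t * w i * v i j)    ≈⟨ sum-cong-≋ (λ i → *-assoc t (w i) (v i j)) ⟩
    ∑ (λ i → t * (w i * v i j))  ≈⟨ *-distribˡ-sum t (λ i → w i * v i j) ⟨
    t * ∑ (λ i → w i * v i j)    ≈⟨ *-congˡ (kernel⇒∑≈0 kw j) ⟩
    t * 0#                       ≈⟨ zeroʳ t ⟩
    0#                           ∎

  Kernel-∑ : ∀ {k} {W : Fin k → Fin n → Carrier} → (∀ g → Kernel (W g)) → Kernel (λ i → ∑ (λ g → W g i))
  Kernel-∑ {W = W} kW = ∑≈0⇒kernel λ j → begin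
    ∑ (λ i → ∑ (λ g → W g i) * v i j)  ≈⟨ sum-cong-≋ (λ i → *-distribʳ-sum (v i j) (λ g → W g i)) ⟩
    ∑ (λ i → ∑ (λ g → W g i * v i j))  ≈⟨ ∑-comm (λ i g → W g i * v i j) ⟩
    ∑ (λ g → ∑ (λ i → W g i * v i j))  ≈⟨ ∑-zero (λ g → kernel⇒∑≈0 (kW g) j) ⟩
    0#                                 ∎

  pencil-kernel : ∀ {x y} → Kernel x → Kernel y → ∀ s → Kernel (Pencil.pencil F x y s)
  pencil-kernel kx ky zero    = kx
  pencil-kernel kx ky (suc t) = Kernel-+ ky (Kernel-* (enum t) kx)

  record LinearDependency (S : Subset n) : Set (c ⊔ ℓ) where
    field
      coefficients : Fin n → Carrier
      vanishes     : VanishesOutside S coefficients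
      kernel       : Kernel coefficients
      index        : Fin n
      nonzero-at   : ¬ coefficients index ≈ 0#

  LinearDependency⇒dependent : ∀ {S} → LinearDependency S → ¬ Ind S
  LinearDependency⇒dependent d ind = nonzero-at (ind coefficients vanishes kernel index)
    where open LinearDependency d

  dependent⇒¬¬LinearDependency : ∀ {S} → ¬ Ind S → ¬ ¬ LinearDependency S
  dependent⇒¬¬LinearDependency ¬ind ¬dependency = ¬ind λ a a≈0 ka i →
    decidable-stable (a i ≈? 0#) (λ aᵢ≉0 → ¬dependency (record
      { coefficients = a ; vanishes = a≈0 ; kernel = ka ; index = i ; nonzero-at = aᵢ≉0 }))

  Ind-stable : ∀ {S} → ¬ ¬ Ind S → Ind S
  Ind-stable ¬¬ind a a≈0 ka i = decidable-stable (a i ≈? 0#) (λ aᵢ≉0 → ¬¬ind (λ ind → aᵢ≉0 (ind a a≈0 ka i)))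

  -- For the dependency u on D: either u e ≉ 0 and u itself will do, or w - (w i / u i) u keeps w e
  -- and kills w i.
  smaller-kernel-vector : ∀ {w e D} → Kernel w → ¬ w e ≈ 0# → D ⊂ support w → LinearDependency D →
                          ∃ λ w′ → Kernel w′ × ¬ w′ e ≈ 0# × support w′ ⊂ support w
  smaller-kernel-vector {w} {e} {D} kw wₑ≉0 D⊂ d with LinearDependency.coefficients d e ≈? 0#
  ... | no uₑ≉0 = coefficients , kernel , uₑ≉0 , ⊆-⊂-trans (vanishesOutside⇒support-⊆ vanishes) D⊂
    where open LinearDependency d
  ... | yes uₑ≈0 = w′ , Kernel-+ kw (Kernel-* t kernel) , wₑ≉0 ∘ trans (sym w′ₑ≈wₑ) , w′⊆w , i , i∈w , i∉w′
    where
    open LinearDependency d renaming (coefficients to u; index to i)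
    t = proj₁ (affine-root nonzero-at (w i))
    w′ : Fin n → Carrier
    w′ j = w j + t * u j
    w′ₑ≈wₑ : w′ e ≈ w e
    w′ₑ≈wₑ = trans (+-congˡ (trans (*-congˡ uₑ≈0) (zeroʳ t))) (+-identityʳ (w e))
    w′⊆w : support w′ ⊆ support w
    w′⊆w = vanishesOutside⇒support-⊆ λ j j∉w →
      trans (+-cong (vanishesOutside-support j j∉w) (trans (*-congˡ (vanishes j (j∉w ∘ proj₁ D⊂))) (zeroʳ t)))
            (+-identityʳ 0#)
    i∈w : i ∈ support w
    i∈w = proj₁ D⊂ (vanishesOutside⇒support-⊆ vanishes (∈-support⁺ nonzero-at))
    i∉w′ : i ∉ support w′
    i∉w′ i∈w′ = ∈-support⁻ i∈w′ (proj₂ (affine-root nonzero-at (w i)))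

  CircuitThrough : Fin n → Subset n → Set (c ⊔ ℓ)
  CircuitThrough e S = ∃ λ C → Circuit Ind C × e ∈ C × C ⊆ S

  circuit-within-support : ∀ {w e} → Kernel w → ¬ w e ≈ 0# → ¬ ¬ CircuitThrough e (support w)
  circuit-within-support kw wₑ≉0 = go (<-wellFounded _) kw wₑ≉0
    where
    go : ∀ {w e} → Acc _<_ ∣ support w ∣ → Kernel w → ¬ w e ≈ 0# → ¬ ¬ CircuitThrough e (support w)
    go {w} {e} (acc smaller) kw wₑ≉0 = ¬¬-excluded-middle >>= by-minimality
      where
      by-minimality : Dec (∀ D → D ⊂ support w → Ind D) → ¬ ¬ CircuitThrough e (support w)
      by-minimality (yes minimal) =
        return (support w , (support-dependent , minimal) , ∈-support⁺ wₑ≉0 , λ {i} i∈ → i∈)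
        where
        support-dependent : ¬ Ind (support w)
        support-dependent = LinearDependency⇒dependent (record
          { coefficients = w ; vanishes = vanishesOutside-support ; kernel = kw ; index = e ; nonzero-at = wₑ≉0 })
      by-minimality (no ¬minimal) = do
        (D , D⊂ , ¬indD) ← some-proper-subset-dependent
        d ← dependent⇒¬¬LinearDependency ¬indD
        let (w′ , kw′ , w′ₑ≉0 , w′⊂w) = smaller-kernel-vector kw wₑ≉0 D⊂ d
        (C , circuit , e∈C , C⊆w′) ← go (smaller (p⊂q⇒∣p∣<∣q∣ w′⊂w)) kw′ w′ₑ≉0
        return (C , circuit , e∈C , λ {i} i∈C → proj₁ w′⊂w (C⊆w′ i∈C))
        where
        some-proper-subset-dependent : ¬ ¬ (∃ λ D → D ⊂ support w × ¬ Ind D)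
        some-proper-subset-dependent ¬∃ = ¬minimal λ D D⊂ → Ind-stable (λ ¬ind → ¬∃ (D , D⊂ , ¬ind))

  loose⇒support-bound : ∀ {r k e w} → KLoose Ind r k e → Kernel w → ¬ w e ≈ 0# → suc r ≤ ∣ support w ∣ ℕ.+ k
  loose⇒support-bound {r} {k} loose kw wₑ≉0 = decidable-stable (suc r ℕ.≤? _) do
    (C , circuit , e∈C , C⊆w) ← circuit-within-support kw wₑ≉0
    return (≤-trans (loose C circuit e∈C) (ℕₚ.+-monoˡ-≤ k (p⊆q⇒∣p∣≤∣q∣ C⊆w)))

  record Fundamental (S : Subset n) (g : Fin n) (x : Fin n → Carrier) : Set ℓ where
    field
      kernel   : Kernel x
      at-self  : x g ≈ 1#
      vanishes : ∀ j → j ∉ S → j ≢ g → x j ≈ 0#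

  fundamental-vector : ∀ {S g} → Ind S → g ∉ S → ¬ Ind (S ∪ ⁅ g ⁆) → ¬ ¬ ∃ (Fundamental S g)
  fundamental-vector {S} {g} indS g∉S ¬ind = do
    d ← dependent⇒¬¬LinearDependency ¬ind
    return (normalise d)
    where
    normalise : LinearDependency (S ∪ ⁅ g ⁆) → ∃ (Fundamental S g)
    normalise d with LinearDependency.coefficients d g ≈? 0#
    ... | yes u_g≈0 = ⊥-elim (nonzero-at (indS u u≈0 kernel index))
      where
      open LinearDependency d renaming (coefficients to u)
      u≈0 : VanishesOutside S u
      u≈0 j j∉S with j Fin.≟ g
      ... | yes ≡.refl = u_g≈0
      ... | no j≢g     = vanishes j (x∉p∧x≢y⇒x∉p∪⁅y⁆ j∉S j≢g)
    ... | no u_g≉0 with inverse (LinearDependency.coefficients d g) u_g≉0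
    ...   | z , u_g*z≈1 = (λ j → z * u j) , record
      { kernel   = Kernel-* z kernel
      ; at-self  = trans (*-comm z (u g)) u_g*z≈1
      ; vanishes = λ j j∉S j≢g → trans (*-congˡ (vanishes j (x∉p∧x≢y⇒x∉p∪⁅y⁆ j∉S j≢g))) (zeroʳ z)
      }
      where open LinearDependency d renaming (coefficients to u)

  basis-fundamental : ∀ {B g} → Basis Ind B → g ∉ B → ¬ ¬ ∃ (Fundamental B g)
  basis-fundamental (indB , maximal) g∉B = fundamental-vector indB g∉B (maximal _ (x∉p⇒p⊂p∪⁅x⁆ g∉B))

  module Expansion {B} (indB : Ind B) (X : ∀ g → g ∉ B → Fin n → Carrier)
                   (X-fundamental : ∀ g g∉B → Fundamental B g (X g g∉B)) where

    component : (Fin n → Carrier) → Fin n → Fin n → Carrier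
    component u g with g ∈? B
    ... | yes _   = λ _ → 0#
    ... | no g∉B = λ i → u g * X g g∉B i

    component-kernel : ∀ u g → Kernel (component u g)
    component-kernel u g with g ∈? B
    ... | yes _   = Kernel-0
    ... | no g∉B = Kernel-* (u g) (Fundamental.kernel (X-fundamental g g∉B))

    component-off : ∀ u {g h} → h ∉ B → g ≢ h → component u g h ≈ 0#
    component-off u {g} {h} h∉B g≢h with g ∈? B
    ... | yes _   = refl
    ... | no g∉B = trans (*-congˡ (Fundamental.vanishes (X-fundamental g g∉B) h h∉B (g≢h ∘ ≡.sym))) (zeroʳ (u g))

    component-self : ∀ u {h} → h ∉ B → component u h h ≈ u h
    component-self u {h} h∉B with h ∈? B
    ... | yes h∈B = ⊥-elim (h∉B h∈B)
    ... | no h∉B′ = trans (*-congˡ (Fundamental.at-self (X-fundamental h h∉B′))) (*-identityʳ (u h))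

    -- The difference is a kernel vector vanishing outside the independent set B, hence zero.
    kernel-expansion : ∀ {u} → Kernel u → ∀ i → u i ≈ ∑ (λ g → component u g i)
    kernel-expansion {u} ku i = x∙y⁻¹≈ε⇒x≈y (u i) (∑u i) (trans (+-congˡ (sym (-1*x≈-x (∑u i)))) (difference≈0 i))
      where
      ∑u : Fin n → Carrier
      ∑u i = ∑ (λ g → component u g i)
      difference≈0 : ∀ i → u i + - 1# * ∑u i ≈ 0#
      difference≈0 = indB _ vanishes-off-B (Kernel-+ ku (Kernel-* (- 1#) (Kernel-∑ (component-kernel u))))
        where
        vanishes-off-B : VanishesOutside B (λ i → u i + - 1# * ∑u i)
        vanishes-off-B h h∉B = begin
          u h + - 1# * ∑u h        ≈⟨ +-congˡ (-1*x≈-x (∑u h)) ⟩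
          u h + - ∑u h             ≈⟨ +-congˡ (-‿cong (∑-single (λ g → component u g h) h
                                                                  (λ g → component-off u h∉B))) ⟩
          u h + - component u h h  ≈⟨ +-congˡ (-‿cong (component-self u h∉B)) ⟩
          u h + - u h              ≈⟨ -‿inverseʳ (u h) ⟩
          0#                       ∎

    module _ (e f : Fin n) where
      open TwoCoordinates e f

      form-vanishes-on-kernel : ∀ {α β} → (∀ g g∉B → form α β (X g g∉B) ≈ 0#) →
                                ∀ {u} → Kernel u → form α β u ≈ 0#
      form-vanishes-on-kernel {α} {β} form-X≈0 {u} ku = begin
        form α β u                                  ≈⟨ form-cong (kernel-expansion ku) ⟩
        form α β (λ i → ∑ (λ g → component u g i))  ≈⟨ form-∑ (component u) ⟩
        ∑ (λ g → form α β (component u g))          ≈⟨ ∑-zero form-component≈0 ⟩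
        0#                                          ∎
        where
        form-component≈0 : ∀ g → form α β (component u g) ≈ 0#
        form-component≈0 g with g ∈? B
        ... | yes _   = form-vanishing refl refl
        ... | no g∉B = trans (form-* (u g) (X g g∉B)) (trans (*-congˡ (form-X≈0 g g∉B)) (zeroʳ (u g)))

      -- det (X a) - vanishes on every X b, hence on u′; so det - u′ vanishes on every X a, hence on u.
      fundamental-dets-not-all-zero : ∀ {u u′} → Kernel u → Kernel u′ → ¬ det u u′ ≈ 0# →
                                      ¬ (∀ a a∉B b b∉B → det (X a a∉B) (X b b∉B) ≈ 0#)
      fundamental-dets-not-all-zero {u} {u′} ku ku′ uu′≉0 all≈0 = uu′≉0 (begin
        det u u′                ≈⟨ det-as-form-of-first u u′ ⟩
        form (u′ f) (- u′ e) u  ≈⟨ form-vanishes-on-kernel X-u′≈0 ku ⟩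
        0#                      ∎)
        where
        X-u′≈0 : ∀ a a∉B → form (u′ f) (- u′ e) (X a a∉B) ≈ 0#
        X-u′≈0 a a∉B = trans (sym (det-as-form-of-first (X a a∉B) u′))
                              (form-vanishes-on-kernel (all≈0 a a∉B) ku′)

module TwoLooseElements {q c ℓ} (F : FiniteField q c ℓ) {m n : ℕ} (v : Fin n → Fin m → FiniteField.Carrier F)
                        {e f : Fin n} (e≢f : e ≢ f) where
  open FiniteField F hiding (zero)
  open FieldProperties F
  open VectorMatroid F v
  open TwoCoordinates e f
  open import Data.Nat using (_≤_)

  record IndependentPair (T : Subset n) : Set (c ⊔ ℓ) where
    field
      x y        : Fin n → Carrier
      kernel-x   : Kernel x
      kernel-y   : Kernel y
      det≉0      : ¬ det x y ≈ 0#
      x-vanishes : VanishesOutside T x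
      y-vanishes : VanishesOutside T y

  coindependent⇒¬¬independent-pair : DualIndep Ind (⁅ e ⁆ ∪ ⁅ f ⁆) → ¬ ¬ IndependentPair ⊤
  coindependent⇒¬¬independent-pair (B , basis , ef⊆∁B) = do
    (x , x-fundamental) ← basis-fundamental basis e∉B
    (y , y-fundamental) ← basis-fundamental basis f∉B
    let open Fundamental x-fundamental renaming (kernel to kernel-x; at-self to xₑ≈1; vanishes to x-vanishes)
        open Fundamental y-fundamental renaming (kernel to kernel-y; at-self to y_f≈1; vanishes to y-vanishes)
        det≈1 = det-units xₑ≈1 (x-vanishes f f∉B (e≢f ∘ ≡.sym)) (y-vanishes e e∉B e≢f) y_f≈1
    return (record
      { x = x ; y = y ; kernel-x = kernel-x ; kernel-y = kernel-y
      ; det≉0 = λ det≈0 → 0≉1 (trans (sym det≈0) det≈1)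
      ; x-vanishes = λ i i∉⊤ → ⊥-elim (i∉⊤ ∈⊤) ; y-vanishes = λ i i∉⊤ → ⊥-elim (i∉⊤ ∈⊤) })
    where
    e∉B = x∈∁p⇒x∉p (ef⊆∁B (x∈p∪q⁺ (inj₁ (x∈⁅x⁆ e))))
    f∉B = x∈∁p⇒x∉p (ef⊆∁B (x∈p∪q⁺ (inj₂ (x∈⁅x⁆ f))))

  independent-pair-within-basis : ∀ {B T} → Basis Ind B → IndependentPair T →
                                  ¬ ¬ ∃₂ λ a b → IndependentPair (B ∪ ⁅ a ⁆ ∪ ⁅ b ⁆)
  independent-pair-within-basis {B} basis@(indB , _) pair = do
    X ← ¬¬-∀-Fin fundamental-outside-B
    pair-of-fundamentals X
    where
    fundamental-outside-B : ∀ g → ¬ ¬ (g ∉ B → ∃ (Fundamental B g))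
    fundamental-outside-B g with g ∈? B
    ... | yes g∈B = return (λ g∉B → ⊥-elim (g∉B g∈B))
    ... | no g∉B  = do
      fundamental ← basis-fundamental basis g∉B
      return (λ _ → fundamental)

    pair-of-fundamentals : (∀ g → g ∉ B → ∃ (Fundamental B g)) →
                           ¬ ¬ ∃₂ λ a b → IndependentPair (B ∪ ⁅ a ⁆ ∪ ⁅ b ⁆)
    pair-of-fundamentals X ¬pair = fundamental-dets-not-all-zero e f kernel-x kernel-y det≉0 λ a a∉B b b∉B →
      decidable-stable (det (X′ a a∉B) (X′ b b∉B) ≈? 0#) (λ ab≉0 → ¬pair (a , b , record
        { x = X′ a a∉B ; y = X′ b b∉B
        ; kernel-x = Fundamental.kernel (X-fundamental a a∉B)
        ; kernel-y = Fundamental.kernel (X-fundamental b b∉B)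
        ; det≉0 = ab≉0
        ; x-vanishes = λ i i∉ → let i∉B , i≢a , _ = x∉p∪⁅y⁆∪⁅z⁆⇒x∉p×x≢y×x≢z i∉ in
            Fundamental.vanishes (X-fundamental a a∉B) i i∉B i≢a
        ; y-vanishes = λ i i∉ → let i∉B , _ , i≢b = x∉p∪⁅y⁆∪⁅z⁆⇒x∉p×x≢y×x≢z i∉ in
            Fundamental.vanishes (X-fundamental b b∉B) i i∉B i≢b
        }))
      where
      open IndependentPair pair
      X′ : ∀ g → g ∉ B → Fin n → Carrier
      X′ g g∉B = proj₁ (X g g∉B)
      X-fundamental : ∀ g g∉B → Fundamental B g (X′ g g∉B)
      X-fundamental g g∉B = proj₂ (X g g∉B)
      open Expansion indB X′ X-fundamental

  independent-pair-bound : ∀ {r k T} → KLoose Ind r k e → KLoose Ind r k f → IndependentPair T →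
                           suc q ℕ.* suc r ≤ q ℕ.* ∣ T ∣ ℕ.+ suc q ℕ.* k
  independent-pair-bound {r} {k} {T} e-loose f-loose pair = begin
    suc q ℕ.* suc r
      ≡⟨ ∑-const (suc q) (suc r) ⟨
    sum {suc q} (λ _ → suc r)
      ≤⟨ ∑-mono-≤ member-bound ⟩
    sum (λ s → ∣ support (pencil s) ∣ ℕ.+ k)
      ≡⟨ ℕΣ.∑-distrib-+ (λ s → ∣ support (pencil s) ∣) (λ _ → k) ⟩
    sum (λ s → ∣ support (pencil s) ∣) ℕ.+ sum {suc q} (λ _ → k)
      ≤⟨ +-mono-≤ (∑∣support∣≤q*∣T∣ x-vanishes y-vanishes) (≤-reflexive (∑-const (suc q) k)) ⟩
    q ℕ.* ∣ T ∣ ℕ.+ suc q ℕ.* k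
      ∎
    where
    open ℕₚ.≤-Reasoning
    open IndependentPair pair
    open Pencil F x y
    member-bound : ∀ s → suc r ≤ ∣ support (pencil s) ∣ ℕ.+ k
    member-bound s with pencil-nonzero e f det≉0 s
    ... | inj₁ ≉0 = loose⇒support-bound e-loose (pencil-kernel kernel-x kernel-y s) ≉0
    ... | inj₂ ≉0 = loose⇒support-bound f-loose (pencil-kernel kernel-x kernel-y s) ≉0

  two-loose-elements-bound : ∀ {r k} → Cosimple Ind → HasRank Ind r → KLoose Ind r k e → KLoose Ind r k f →
                             suc q ℕ.* suc r ≤ q ℕ.* (r ℕ.+ 2) ℕ.+ suc q ℕ.* k
  two-loose-elements-bound {r} {k} cosimple (B , basis , ∣B∣≡r) e-loose f-loose = decidable-stable (_ ℕ.≤? _) do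
    ef-coindependent ← cosimple⇒¬¬pair-coindependent basis cosimple e≢f
    pair ← coindependent⇒¬¬independent-pair ef-coindependent
    (a , b , pair-within-B) ← independent-pair-within-basis basis pair
    let ∣T∣≤r+2 = ≡.subst (λ s → ∣ B ∪ ⁅ a ⁆ ∪ ⁅ b ⁆ ∣ ≤ s ℕ.+ 2) ∣B∣≡r (∣p∪⁅x⁆∪⁅y⁆∣≤∣p∣+2 B a b)
    return (≤-trans (independent-pair-bound e-loose f-loose pair-within-B)
                    (ℕₚ.+-monoˡ-≤ (suc q ℕ.* k) (ℕₚ.*-monoʳ-≤ q ∣T∣≤r+2)))

open import Data.Integer using (+_; _-_; _≤_)
import Data.Integer as ℤ
import Data.Integer.Properties as ℤₚ
import Data.Integer.Tactic.RingSolver as ℤ-Solver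
import Data.Nat.Tactic.RingSolver as ℕ-Solver

ℕ-bound⇒ℤ-bound : ∀ q r k → suc q ℕ.* suc r ℕ.≤ q ℕ.* (r ℕ.+ 2) ℕ.+ suc q ℕ.* k →
                  + r ≤ (+ (suc q) ℤ.* (+ k - + 1)) ℤ.+ + (2 ℕ.* q)
ℕ-bound⇒ℤ-bound q r k bound = ≡.subst₂ _≤_ r+s-s≡r sk+2q-s≡goal (ℤₚ.+-monoˡ-≤ (ℤ.- + suc q) (ℤ.+≤+ r+s≤sk+2q))
  where
  r+s≤sk+2q : r ℕ.+ suc q ℕ.≤ suc q ℕ.* k ℕ.+ 2 ℕ.* q
  r+s≤sk+2q = ℕₚ.+-cancelˡ-≤ (q ℕ.* r) _ _ (≡.subst₂ ℕ._≤_ (expand-lhs q r) (expand-rhs q r k) bound)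
    where
    expand-lhs : ∀ q r → suc q ℕ.* suc r ≡ q ℕ.* r ℕ.+ (r ℕ.+ suc q)
    expand-lhs = ℕ-Solver.solve-∀
    expand-rhs : ∀ q r k → q ℕ.* (r ℕ.+ 2) ℕ.+ suc q ℕ.* k ≡ q ℕ.* r ℕ.+ (suc q ℕ.* k ℕ.+ 2 ℕ.* q)
    expand-rhs = ℕ-Solver.solve-∀

  r+s-s≡r : + (r ℕ.+ suc q) - + suc q ≡ + r
  r+s-s≡r = ≡.trans (≡.cong (_- + suc q) (ℤₚ.pos-+ r (suc q))) (cancel (+ r) (+ suc q))
    where
    cancel : ∀ i j → i ℤ.+ j - j ≡ i
    cancel = ℤ-Solver.solve-∀

  sk+2q-s≡goal : + (suc q ℕ.* k ℕ.+ 2 ℕ.* q) - + suc q ≡ (+ (suc q) ℤ.* (+ k - + 1)) ℤ.+ + (2 ℕ.* q)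
  sk+2q-s≡goal = ≡.trans (≡.cong (_- + suc q) (≡.trans (ℤₚ.pos-+ (suc q ℕ.* k) (2 ℕ.* q))
                                                        (≡.cong (ℤ._+ + (2 ℕ.* q)) (ℤₚ.pos-* (suc q) k))))
                         (regroup (+ suc q) (+ k) (+ (2 ℕ.* q)))
    where
    regroup : ∀ a i j → a ℤ.* i ℤ.+ j - a ≡ a ℤ.* (i - + 1) ℤ.+ j
    regroup = ℤ-Solver.solve-∀

corollary3p3 : {c ℓ : Level} (q k : ℕ) → IsPrimePower q →
    (F : FiniteField q c ℓ) →
    {m n : ℕ} (v : Fin n → Fin m → FiniteField.Carrier F) →
    Simple (VecIndep F v) → Cosimple (VecIndep F v) →
    (r : ℕ) → HasRank (VecIndep F v) r →
    (e f : Fin n) → e ≢ f →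
    KLoose (VecIndep F v) r k e → KLoose (VecIndep F v) r k f →
    + r ≤ (+ (suc q) ℤ.* (+ k - + 1)) ℤ.+ + (2 ℕ.* q)
corollary3p3 q k _ F v _ cosimple r rank e f e≢f e-loose f-loose =
  ℕ-bound⇒ℤ-bound q r k (TwoLooseElements.two-loose-elements-bound F v e≢f cosimple rank e-loose f-loose)
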